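{- There is a sentential logic whose consequence relation is monotonic, reflexive and transitive, but which has no truth-adequate intersective mixed semantics whose set of truth values has exactly two elements.
   Context: A sentential logic is a triple $\langle\mathcal{L},\mathcal{C},\vdash\rangle$ where $\mathcal{L}$ is the set of formulae freely generated from a set of atoms by a set $\mathcal{C}$ of connectives, and $\vdash\subseteq\mathcal{P}(\mathcal{L})\times\mathcal{P}(\mathcal{L})$. $\vdash$ is monotonic if $\Gamma_1\subseteq\Gamma_2$, $\Delta_1\subseteq\Delta_2$, $\Gamma_1\vdash\Delta_1$ imply $\Gamma_2\vdash\Delta_2$; reflexive if $\{F\}\vdash\{F\}$ for every formula $F$; transitive if whenever $\Gamma\not\vdash\Delta$ there are $\Gamma'\supseteq\Gamma$, $\Delta'\supseteq\Delta$ with $\Gamma'\not\vdash\Delta'$ and $\Gamma'\cup\Delta'=\mathcal{L}$. A semantics is a triple $\langle\mathcal{V},\mathcal{W},[\![\cdot]\!]\rangle$: truth values $\mathcal{V}$, worlds $\mathcal{W}$, and $[\![\cdot]\!]$ assigning to formulae propositions $\mathcal{W}\to\mathcal{V}$, to $n$-ary connectives functions on $n$-tuples of propositions, and to $\vdash$ a relation $\models$ between sets of propositions. It is compositional if $[\![c(F_1,\dots,F_n)]\!]=[\![c]\!]([\![F_1]\!],\dots,[\![F_n]\!])$; sound and complete if $\Gamma\vdash\Delta$ iff $\{[\![F]\!]:F\in\Gamma\}\models\{[\![F]\!]:F\in\Delta\}$; truth-functional if for each $n$-ary $c$ there is $f_c:\mathcal{V}^n\to\mathcal{V}$ with $[\![c]\!](P_1,\dots,P_n)(w)=f_c(P_1(w),\dots,P_n(w))$;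 truth-relational if there is $\Vdash\subseteq\mathcal{P}(\mathcal{V})\times\mathcal{P}(\mathcal{V})$ with $S\models P$ iff $S(w)\Vdash P(w)$ for all $w$, where $S(w)=\{Q(w):Q\in S\}$; truth-adequate if it has all four properties. For $D_p,D_c\subseteq\mathcal{V}$, $\gamma\Vdash_{D_p,D_c}\delta$ iff ($\gamma\subseteq D_p$ implies $\delta\cap D_c\neq\emptyset$). A semantics is intersective mixed if it is truth-relational and its truth-relation is an intersection of relations of the form $\Vdash_{D_p,D_c}$. -}

module Defs where

open import Level using (Level; 0ℓ; _⊔_; Setω) renaming (suc to lsuc)
open import Data.Nat using (ℕ)
open import Data.Fin using (Fin)
open import Data.Product using (Σ; ∃; _×_; _,_)
open import Data.Sum using (_⊎_)
open import Relation.Nullary using (¬_)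
open import Relation.Binary.PropositionalEquality using (_≡_)
open import Function.Bundles using (_↔_)

PSet : ∀ {ℓ} → Set ℓ → (ℓ' : Level) → Set (ℓ ⊔ lsuc ℓ')
PSet A ℓ' = A → Set ℓ'

_⊆_ : ∀ {ℓ ℓ'} {A : Set ℓ} → PSet A ℓ' → PSet A ℓ' → Set (ℓ ⊔ ℓ')
S ⊆ T = ∀ x → S x → T x

data Form (Atom Conn : Set) (ar : Conn → ℕ) : Set where
  atom : Atom → Form Atom Conn ar
  app  : (c : Conn) → (Fin (ar c) → Form Atom Conn ar) → Form Atom Conn ar

record Logic : Set₁ where
  field
    Atom  : Set
    Conn  : Set
    arity : Conn → ℕ
    _⊢_   : PSet (Form Atom Conn arity) 0ℓ → PSet (Form Atom Conn arity) 0ℓ → Set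

  L : Set
  L = Form Atom Conn arity

  Monotonic : Set₁
  Monotonic = ∀ (Γ₁ Γ₂ Δ₁ Δ₂ : PSet L 0ℓ) →
    Γ₁ ⊆ Γ₂ → Δ₁ ⊆ Δ₂ → Γ₁ ⊢ Δ₁ → Γ₂ ⊢ Δ₂

  singleton : L → PSet L 0ℓ
  singleton F = λ G → G ≡ F

  Reflexive : Set
  Reflexive = ∀ (F : L) → singleton F ⊢ singleton F

  Transitive : Set₁
  Transitive = ∀ (Γ Δ : PSet L 0ℓ) → ¬ (Γ ⊢ Δ) →
    Σ (PSet L 0ℓ) λ Γ' → Σ (PSet L 0ℓ) λ Δ' →
      (Γ ⊆ Γ') × (Δ ⊆ Δ') × ¬ (Γ' ⊢ Δ') × (∀ F → Γ' F ⊎ Δ' F)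

record Semantics (𝓛 : Logic) (ℓ : Level) : Set (lsuc ℓ) where
  open Logic 𝓛
  field
    V : Set ℓ
    W : Set ℓ
  Prop : Set ℓ
  Prop = W → V
  field
    ⟦_⟧    : L → Prop
    ⟦_⟧ᶜ   : (c : Conn) → (Fin (arity c) → Prop) → Prop
    _⊨_    : PSet Prop ℓ → PSet Prop ℓ → Set ℓ

  img : PSet L 0ℓ → PSet Prop ℓ
  img Γ P = Σ L λ F → Γ F × (⟦ F ⟧ ≡ P)

  at : PSet Prop ℓ → W → PSet V ℓ
  at S w v = Σ Prop λ Q → S Q × (Q w ≡ v)

  -- equality of propositions is taken pointwise
  Compositional : Set ℓ
  Compositional = ∀ (c : Conn) (Fs : Fin (arity c) → L) (w : W) →
    ⟦ app c Fs ⟧ w ≡ ⟦ c ⟧ᶜ (λ i → ⟦ Fs i ⟧) w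

  SoundComplete : Set (lsuc 0ℓ ⊔ ℓ)
  SoundComplete = ∀ (Γ Δ : PSet L 0ℓ) →
    ((Γ ⊢ Δ) → (img Γ ⊨ img Δ)) × ((img Γ ⊨ img Δ) → (Γ ⊢ Δ))

  TruthFunctional : Set ℓ
  TruthFunctional = ∀ (c : Conn) → Σ ((Fin (arity c) → V) → V) λ f →
    ∀ (Ps : Fin (arity c) → Prop) (w : W) → ⟦ c ⟧ᶜ Ps w ≡ f (λ i → Ps i w)

  TruthRelationalVia : (PSet V ℓ → PSet V ℓ → Set ℓ) → Set (lsuc ℓ)
  TruthRelationalVia _⊩_ = ∀ (S T : PSet Prop ℓ) →
    ((S ⊨ T) → (∀ w → at S w ⊩ at T w)) × ((∀ w → at S w ⊩ at T w) → (S ⊨ T))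

  TruthRelational : Set (lsuc ℓ)
  TruthRelational = Σ (PSet V ℓ → PSet V ℓ → Set ℓ) TruthRelationalVia

  TruthAdequate : Set (lsuc ℓ)
  TruthAdequate = Compositional × SoundComplete × TruthFunctional × TruthRelational

Mixed : ∀ {ℓ} {V : Set ℓ} → PSet V ℓ → PSet V ℓ → PSet V ℓ → PSet V ℓ → Set ℓ
Mixed Dp Dc γ δ = γ ⊆ Dp → Σ _ λ v → δ v × Dc v

IsIntersectionOfMixed : ∀ {ℓ} {V : Set ℓ} → (PSet V ℓ → PSet V ℓ → Set ℓ) → Set (lsuc ℓ)
IsIntersectionOfMixed {ℓ} {V} _⊩_ =
  Σ (Set ℓ) λ I → Σ (I → PSet V ℓ) λ Dp → Σ (I → PSet V ℓ) λ Dc →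
    ∀ (γ δ : PSet V ℓ) →
      ((γ ⊩ δ) → (∀ i → Mixed (Dp i) (Dc i) γ δ)) ×
      ((∀ i → Mixed (Dp i) (Dc i) γ δ) → (γ ⊩ δ))

module _ {𝓛 : Logic} {ℓ : Level} (𝕊 : Semantics 𝓛 ℓ) where
  open Semantics 𝕊
  IntersectiveMixed : Set (lsuc ℓ)
  IntersectiveMixed = Σ (PSet V ℓ → PSet V ℓ → Set ℓ) λ ⊩ →
    TruthRelationalVia ⊩ × IsIntersectionOfMixed ⊩

  TwoValued : Set ℓ
  TwoValued = V ↔ Fin 2

record Fact4p9 : Setω where
  field
    logic      : Logic
    monotonic  : Logic.Monotonic logic
    reflexive  : Logic.Reflexive logic
    transitive : Logic.Transitive logic
    noSemantics : ∀ {ℓ} (𝕊 : Semantics logic ℓ) →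
      ¬ (Semantics.TruthAdequate 𝕊 × IntersectiveMixed 𝕊 × TwoValued 𝕊)

-- The logic has one atom p and one unary connective c, so its formulae are the
-- iterates cⁿ p; Γ ⊢ Δ holds iff Γ contains some cⁿ p with n ≠ 3 or Δ contains c³ p.
-- It is monotonic, reflexive and transitive because it is the single mixed relation
-- with Dp = Dc = {c³ p}, read off formulae. On a two-element set every function g
-- satisfies g³ = g, so a truth-functional, compositional semantics gives c³ p and c p
-- the same proposition. Intersective mixed relations only depend on the premise values,
-- so {c p} ⊢ {c p} would force {c³ p} ⊢ {c p}, which fails.
module Submission where

open import Defs
open import Level using (Level; 0ℓ)
open import Data.Nat using (ℕ; zero; suc; _≟_)
open import Data.Fin using (Fin; zero; suc)
open import Data.Unit using (⊤; tt)
open import Data.Empty using (⊥-elim)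
open import Data.Product using (Σ; _×_; _,_; proj₁; proj₂)
open import Data.Sum using (_⊎_; inj₁; inj₂)
open import Relation.Nullary using (¬_; yes; no)
open import Relation.Unary using (Decidable)
open import Relation.Binary.PropositionalEquality using (_≡_; refl; sym; cong; module ≡-Reasoning)
open import Function.Bundles using (_↔_; Inverse)

module PivotLogic {Atom Conn : Set} {ar : Conn → ℕ}
                  (A : Form Atom Conn ar → Set) (A? : Decidable A) where

  _⊢ᴬ_ : PSet (Form Atom Conn ar) 0ℓ → PSet (Form Atom Conn ar) 0ℓ → Set
  Γ ⊢ᴬ Δ = (Σ _ λ F → Γ F × ¬ A F) ⊎ (Σ _ λ F → Δ F × A F)

  pivotLogic : Logic
  pivotLogic = record { Atom = Atom ; Conn = Conn ; arity = ar ; _⊢_ = _⊢ᴬ_ }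

  open Logic pivotLogic using (Monotonic; Reflexive; Transitive)

  monotonic : Monotonic
  monotonic _ _ _ _ Γ₁⊆Γ₂ _ (inj₁ (F , F∈Γ₁ , ¬AF)) = inj₁ (F , Γ₁⊆Γ₂ F F∈Γ₁ , ¬AF)
  monotonic _ _ _ _ _ Δ₁⊆Δ₂ (inj₂ (F , F∈Δ₁ , AF)) = inj₂ (F , Δ₁⊆Δ₂ F F∈Δ₁ , AF)

  reflexive : Reflexive
  reflexive F with A? F
  ... | yes AF = inj₂ (F , refl , AF)
  ... | no ¬AF = inj₁ (F , refl , ¬AF)

  -- The maximal counter-model is the partition into A and its complement.
  transitive : Transitive
  transitive Γ Δ Γ⊬Δ = A , (λ F → ¬ A F) , Γ⊆A , Δ⊆∁A , A⊬∁A , A-or-∁A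
    where
    Γ⊆A : Γ ⊆ A
    Γ⊆A F F∈Γ with A? F
    ... | yes AF = AF
    ... | no ¬AF = ⊥-elim (Γ⊬Δ (inj₁ (F , F∈Γ , ¬AF)))

    Δ⊆∁A : Δ ⊆ (λ F → ¬ A F)
    Δ⊆∁A F F∈Δ AF = Γ⊬Δ (inj₂ (F , F∈Δ , AF))

    A⊬∁A : ¬ (A ⊢ᴬ (λ F → ¬ A F))
    A⊬∁A (inj₁ (F , AF , ¬AF)) = ¬AF AF
    A⊬∁A (inj₂ (F , ¬AF , AF)) = ¬AF AF

    A-or-∁A : ∀ F → A F ⊎ ¬ A F
    A-or-∁A F with A? F
    ... | yes AF = inj₁ AF
    ... | no ¬AF = inj₂ ¬AF

cube-Fin2 : (h : Fin 2 → Fin 2) (x : Fin 2) → h (h (h x)) ≡ h x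
cube-Fin2 h x with h zero in e₀ | h (suc zero) in e₁
cube-Fin2 h zero       | zero     | _        rewrite e₀ | e₀ = e₀
cube-Fin2 h zero       | suc zero | zero     rewrite e₀ | e₁ = e₀
cube-Fin2 h zero       | suc zero | suc zero rewrite e₀ | e₁ = e₁
cube-Fin2 h (suc zero) | _        | suc zero rewrite e₁ | e₁ = e₁
cube-Fin2 h (suc zero) | zero     | zero     rewrite e₁ | e₀ = e₀
cube-Fin2 h (suc zero) | suc zero | zero     rewrite e₁ | e₀ = e₁

↔Fin2⇒cube : ∀ {ℓ} {V : Set ℓ} → V ↔ Fin 2 → (g : V → V) (x : V) → g (g (g x)) ≡ g x
↔Fin2⇒cube V↔2 g x = begin
  g (g (g x))            ≡⟨ sym (strictlyInverseʳ _) ⟩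
  from (to (g (g (g x)))) ≡⟨ cong from (to∘g≡h∘to (g (g x))) ⟩
  from (h (to (g (g x)))) ≡⟨ cong (λ y → from (h y)) (to∘g≡h∘to (g x)) ⟩
  from (h (h (to (g x)))) ≡⟨ cong (λ y → from (h (h y))) (to∘g≡h∘to x) ⟩
  from (h (h (h (to x)))) ≡⟨ cong from (cube-Fin2 h (to x)) ⟩
  from (h (to x))         ≡⟨ cong from (sym (to∘g≡h∘to x)) ⟩
  from (to (g x))         ≡⟨ strictlyInverseʳ _ ⟩
  g x                     ∎
  where
  open Inverse V↔2
  open ≡-Reasoning

  h : Fin 2 → Fin 2
  h y = to (g (from y))

  to∘g≡h∘to : ∀ y → to (g y) ≡ h (to y)
  to∘g≡h∘to y = cong (λ z → to (g z)) (sym (strictlyInverseʳ y))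

Mixed-monoˡ : ∀ {ℓ} {V : Set ℓ} {Dp Dc γ γ' δ : PSet V ℓ} →
              γ ⊆ γ' → Mixed Dp Dc γ δ → Mixed Dp Dc γ' δ
Mixed-monoˡ γ⊆γ' γ⊩δ γ'⊆Dp = γ⊩δ (λ v v∈γ → γ'⊆Dp v (γ⊆γ' v v∈γ))

IntersectionOfMixed-monoˡ : ∀ {ℓ} {V : Set ℓ} {_⊩_ : PSet V ℓ → PSet V ℓ → Set ℓ} →
  IsIntersectionOfMixed _⊩_ → ∀ {γ γ' δ} → γ ⊆ γ' → γ ⊩ δ → γ' ⊩ δ
IntersectionOfMixed-monoˡ (_ , _ , _ , ⊩⇔mixed) γ⊆γ' γ⊩δ =
  proj₂ (⊩⇔mixed _ _) λ i → Mixed-monoˡ γ⊆γ' (proj₁ (⊩⇔mixed _ _) γ⊩δ i)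

module _ {𝓛 : Logic} {ℓ : Level} (𝕊 : Semantics 𝓛 ℓ) where
  open Logic 𝓛 using (L; _⊢_; singleton)
  open Semantics 𝕊

  ⊨-monoˡ : IntersectiveMixed 𝕊 → ∀ {S S' T} →
            (∀ w → at S w ⊆ at S' w) → S ⊨ T → S' ⊨ T
  ⊨-monoˡ (_ , truthRel , intersection) S⊆S' S⊨T =
    proj₂ (truthRel _ _) λ w →
      IntersectionOfMixed-monoˡ intersection (S⊆S' w) (proj₁ (truthRel _ _) S⊨T w)

  at-img-singleton-⊆ : ∀ {F G} → (∀ w → ⟦ F ⟧ w ≡ ⟦ G ⟧ w) →
                       ∀ w → at (img (singleton F)) w ⊆ at (img (singleton G)) w
  at-img-singleton-⊆ {G = G} ⟦F⟧≗⟦G⟧ w _ (_ , (_ , refl , refl) , refl) =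
    ⟦ G ⟧ , (G , refl , refl) , sym (⟦F⟧≗⟦G⟧ w)

  singleton-⊢-transfer : SoundComplete → IntersectiveMixed 𝕊 →
    ∀ {F G} Δ → (∀ w → ⟦ F ⟧ w ≡ ⟦ G ⟧ w) → singleton F ⊢ Δ → singleton G ⊢ Δ
  singleton-⊢-transfer sc im Δ ⟦F⟧≗⟦G⟧ F⊢Δ =
    proj₂ (sc _ Δ) (⊨-monoˡ im (at-img-singleton-⊆ ⟦F⟧≗⟦G⟧) (proj₁ (sc _ Δ) F⊢Δ))

Fm : Set
Fm = Form ⊤ ⊤ (λ _ → 1)

c^_ : ℕ → Fm
c^ zero  = atom tt
c^ suc n = app tt (λ _ → c^ n)

depth : Fm → ℕ
depth (atom _)  = 0
depth (app _ F) = suc (depth (F zero))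

open PivotLogic (λ F → depth F ≡ 3) (λ F → depth F ≟ 3)

module _ {ℓ : Level} (𝕊 : Semantics pivotLogic ℓ) where
  open Semantics 𝕊
  open Logic pivotLogic using (singleton)

  ⟦c³⟧≗⟦c¹⟧ : Compositional → TruthFunctional → TwoValued 𝕊 →
              ∀ w → ⟦ c^ 3 ⟧ w ≡ ⟦ c^ 1 ⟧ w
  ⟦c³⟧≗⟦c¹⟧ comp tf V↔2 w = begin
    ⟦ c^ 3 ⟧ w              ≡⟨ ⟦c^suc⟧ 2 ⟩
    g (⟦ c^ 2 ⟧ w)          ≡⟨ cong g (⟦c^suc⟧ 1) ⟩
    g (g (⟦ c^ 1 ⟧ w))      ≡⟨ cong (λ v → g (g v)) (⟦c^suc⟧ 0) ⟩
    g (g (g (⟦ c^ 0 ⟧ w)))  ≡⟨ ↔Fin2⇒cube V↔2 g _ ⟩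
    g (⟦ c^ 0 ⟧ w)          ≡⟨ sym (⟦c^suc⟧ 0) ⟩
    ⟦ c^ 1 ⟧ w              ∎
    where
    open ≡-Reasoning

    g : V → V
    g v = proj₁ (tf tt) (λ _ → v)

    ⟦c^suc⟧ : ∀ n → ⟦ c^ suc n ⟧ w ≡ g (⟦ c^ n ⟧ w)
    ⟦c^suc⟧ n = begin
      ⟦ c^ suc n ⟧ w                 ≡⟨ comp tt (λ _ → c^ n) w ⟩
      ⟦ tt ⟧ᶜ (λ _ → ⟦ c^ n ⟧) w     ≡⟨ proj₂ (tf tt) (λ _ → ⟦ c^ n ⟧) w ⟩
      g (⟦ c^ n ⟧ w)                 ∎

  no-semantics : ¬ (TruthAdequate × IntersectiveMixed 𝕊 × TwoValued 𝕊)
  no-semantics ((comp , sc , tf , _) , im , V↔2) = c³⊬c¹ c³⊢c¹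
    where
    c³⊢c¹ : singleton (c^ 3) ⊢ᴬ singleton (c^ 1)
    c³⊢c¹ = singleton-⊢-transfer 𝕊 sc im (singleton (c^ 1))
              (λ w → sym (⟦c³⟧≗⟦c¹⟧ comp tf V↔2 w)) (reflexive (c^ 1))

    c³⊬c¹ : ¬ (singleton (c^ 3) ⊢ᴬ singleton (c^ 1))
    c³⊬c¹ (inj₁ (_ , refl , depth≢3)) = depth≢3 refl
    c³⊬c¹ (inj₂ (_ , refl , ()))

fact4p9 : Fact4p9
fact4p9 = record
  { logic       = pivotLogic
  ; monotonic   = monotonic
  ; reflexive   = reflexive
  ; transitive  = transitive
  ; noSemantics = no-semantics
  }
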